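{- For each $n,m\ge 0$, \[ \mathfrak{S}\times\mathcal{G}^{01}_m=\mathit{L}\bigl((1+X)^m-1\bigr) \quad\text{and}\quad |\mathcal{G}^{01}_m[n]|=\sum_{\alpha\models n}\prod_{a\in\alpha}\binom{m}{a}. \]
   Context: For a finite totally ordered set $\ell=\{u_1<\dots<u_n\}$, a $\mathcal{G}^{01}_m$-structure on $\ell$ is a matrix with $m$ rows and some number $k\ge 0$ of columns, whose entries are words of length at most one (i.e. empty or a single element) on pairwise disjoint sets, such that concatenating the entries column by column (top to bottom within columns, columns left to right) gives $u_1\cdots u_n$, and every column has a nonempty entry; $\mathcal{G}^{01}_m[n]=\mathcal{G}^{01}_m[\{1,\dots,n\}]$, equinumerous with $m$-row $0/1$ matrices with $n$ ones and no zero column. $(\mathfrak{S}\times\mathcal{G}^{01}_m)[\ell]$ consists of pairs $(w,A)$ with $w$ a permutation of $\ell$ and $A\in\mathcal{G}^{01}_m[\ell]$. An $\mathit{L}((1+X)^m-1)$-structure on $\ell$ is a set partition of $\ell$ together with a linear order of its blocks, each block $B$ carrying an $m$-tuple of pairwise disjoint subsets of $B$, each of size at most one, with union $B$ and not all empty (i.e. an injection $B\to\{1,\dots,m\}$). Equality of $\mathbb{L}$-species means natural isomorphism, which for $\mathbb{L}$-species is equivalent to equinumerosity on each $n$-element set. $\alpha\models n$ means $\alpha=(a_1,\dots,a_k)$ is a composition of $n$ (positive integers summing to $n$; the empty composition for $n=0$). -}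

module Defs where

open import Data.Nat using (ℕ; zero; suc; _∸_)
open import Data.Nat.Combinatorics using (_C_)
open import Data.Fin using (Fin)
open import Data.Maybe using (Maybe; Is-just)
open import Data.Maybe using (just; nothing)
open import Data.List using (List; []; _∷_; allFin; concatMap; map; applyUpTo)
open import Data.Nat.ListAction using (sum; product)
open import Data.List.Relation.Unary.Unique.Propositional using (Unique)
open import Data.List.Relation.Binary.Permutation.Propositional using (_↭_)
open import Data.Vec using (Vec; toList)
open import Data.Vec.Relation.Unary.All using (All)
open import Data.Vec.Relation.Unary.Any using (Any)
open import Relation.Binary.PropositionalEquality using (_≡_)

-- The ground set ℓ = {1 < ... < n} is modelled by Fin n with its order.
-- All side conditions are stored as *irrelevant* fields, so two
-- structures are equal iff their underlying data are equal.

record Perm (n : ℕ) : Set where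
  constructor perm
  field
    word : Vec (Fin n) n
    .distinct : Unique (toList word)

-- An m × k matrix whose entries are words of length at most one on ℓ,
-- stored as k columns, each column a vector of its m entries (top to
-- bottom).  A word of length ≤ 1 is an element of Maybe (Fin n).
Matrix : ℕ → ℕ → ℕ → Set
Matrix n m k = Vec (Vec (Maybe (Fin n)) m) k

maybeWord : ∀ {n} → Maybe (Fin n) → List (Fin n)
maybeWord nothing  = []
maybeWord (just x) = x ∷ []

reading : ∀ {n m k} → Matrix n m k → List (Fin n)
reading M = concatMap (λ col → concatMap maybeWord (toList col)) (toList M)

record G01Mat (m n k : ℕ) : Set where
  constructor g01
  field
    mat : Matrix n m k
    .readsId  : reading mat ≡ allFin n
    .nonzero  : All (Any Is-just) mat

G01 : ℕ → ℕ → Set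
G01 m n = Data.Product.Σ ℕ (G01Mat m n)
  where import Data.Product

-- An L((1+X)^m - 1)-structure on ℓ = Fin n: a linearly ordered list of
-- k blocks; each block is given by its m-tuple of pairwise disjoint subsets
-- of size ≤ 1 (each an element of Maybe (Fin n)), not all empty; the block
-- itself is the union of the tuple.  The blocks form a set partition of ℓ,
-- i.e. every element of ℓ occurs exactly once in total among all tuples
-- (this also gives disjointness inside each tuple).
record LMat (m n k : ℕ) : Set where
  constructor lstr
  field
    blocks : Matrix n m k
    .partition : reading blocks ↭ allFin n
    .nonempty  : All (Any Is-just) blocks

LStr : ℕ → ℕ → Set
LStr m n = Data.Product.Σ ℕ (LMat m n)
  where import Data.Product

-- Compositions of n: lists (a₁,…,a_k) of positive integers summing to n.
-- compositions' fuel n enumerates them by the first part a ∈ {1,…,n};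
-- fuel n suffices since each part is ≥ 1.
compositions' : ℕ → ℕ → List (List ℕ)
compositions' _        zero    = [] ∷ []
compositions' zero     (suc n) = []
compositions' (suc f) (suc n)  =
  concatMap (λ a → map (suc a ∷_) (compositions' f (suc n ∸ suc a)))
            (applyUpTo (λ i → i) (suc n))

compositions : ℕ → List (List ℕ)
compositions n = compositions' n n

compositionSum : ℕ → ℕ → ℕ
compositionSum m n = sum (map (λ α → product (map (m C_) α)) (compositions n))

-- A matrix whose entries are words of length ≤ 1 is determined by its 0/1 shape
-- (which entries are nonempty) together with its reading word, and any word of
-- the right length can be filled into a given shape.  A G⁰¹ₘ-structure is a
-- shape filled with u₁⋯uₙ in order, an L((1+X)ᵐ−1)-structure is a shape
-- filled with an arbitrary arrangement of ℓ, i.e. a permutation; this gives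
-- the first identity.  For the count, a 0/1 matrix with n ones and no zero
-- column is a first column, an a-subset of the m rows with 1 ≤ a ≤ n, followed
-- by such a matrix with n − a ones; the composition sum satisfies the same
-- recursion, by splitting off the first part of the composition.

module Submission where

open import Defs
open import Data.Empty using (⊥-elim-irr)
open import Data.Fin.Base using (Fin; zero; suc; toℕ; fromℕ<; punchOut)
import Data.Fin.Properties as Fin
open import Data.Fin.Subset using (Subset; inside; outside; ∣_∣) renaming (⊥ to ∅)
open import Data.Fin.Subset.Properties using () renaming (∣⊥∣≡0 to ∣∅∣≡0)
open import Data.List.Base as List using (List; []; _∷_; _++_; length; map; concatMap; applyUpTo; allFin; take; drop)
import Data.List.Properties as List
open import Data.List.Membership.Propositional.Properties using (∈-allFin)
open import Data.List.Membership.Propositional.Properties.WithK using (unique∧set⇒bag)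
open import Data.List.Relation.Binary.BagAndSetEquality using (∼bag⇒↭)
open import Data.List.Relation.Binary.Permutation.Propositional using (_↭_; ↭-sym; ↭⇒↭ₛ)
open import Data.List.Relation.Binary.Permutation.Propositional.Properties using (↭-length)
import Data.List.Relation.Binary.Permutation.Setoid.Properties as Permutationₛ
open import Data.List.Relation.Unary.Unique.Propositional using (Unique)
open import Data.List.Relation.Unary.Unique.Propositional.Properties using (allFin⁺)
open import Data.Maybe.Base using (Maybe; just; nothing; is-just)
open import Data.Maybe using (Is-just)
import Data.Maybe.Relation.Unary.Any as Maybe
open import Data.Nat.Base using (ℕ; zero; suc; pred; _+_; _*_; _∸_; _≤_; _<_; s≤s; z<s)
open import Data.Nat.Properties
  using (_≟_; suc-injective; 0≢1+n; 1+n≰n; <⇒≢; m+n≡0⇒m≡0; m≤m+n; m+n∸m≡n; m+[n∸m]≡n; m∸n≤m; ≤-refl; ≤-trans; ≤-reflexive; *-distribˡ-+; *-zeroʳ)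
open import Data.Nat.Combinatorics using (_C_; nCk+nC[k+1]≡[n+1]C[k+1])
open import Data.Nat.ListAction using (sum; product)
open import Data.Nat.ListAction.Properties using (sum-++)
open import Data.Product.Base using (Σ; _×_; _,_; proj₁; proj₂)
open import Data.Product.Algebra using (×-cong)
open import Data.Product.Function.Dependent.Propositional using (Σ-↔)
open import Data.Sum.Base using (_⊎_; inj₁; inj₂)
open import Data.Sum.Algebra using (⊎-cong)
open import Data.Unit.Base using (tt)
open import Data.Vec.Base as Vec using (Vec; []; _∷_; toList; lookup)
import Data.Vec.Properties as Vec
open import Data.Vec.Relation.Unary.All as All using (All; []; _∷_)
import Data.Vec.Relation.Unary.All.Properties as All
open import Data.Vec.Relation.Unary.Any using (Any; here; there; any?)
import Data.List.Relation.Unary.AllPairs as ListAllPairs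
import Data.Vec.Relation.Unary.AllPairs as VecAllPairs
import Data.Vec.Relation.Unary.Unique.Propositional as Vec
open import Data.Vec.Relation.Unary.Unique.Propositional.Properties using (lookup-injective)
open import Data.Vec.Membership.Propositional using () renaming (_∈_ to _∈ᵥ_)
open import Data.Vec.Membership.Propositional.Properties using (∈-lookup; ∈-toList⁺)
open import Function.Base using (id; _∘_)
open import Function.Bundles using (_↔_; mk↔ₛ′; mk⇔)
open import Function.Definitions using (Injective)
open import Function.Properties.Inverse using (↔-refl; ↔-trans)
open import Function.Related.Propositional using (module EquationalReasoning; bijection)
open import Relation.Binary.PropositionalEquality
  using (_≡_; _≢_; refl; sym; trans; cong; cong₂; subst; setoid; module ≡-Reasoning)
open import Relation.Nullary using (yes; no; contradiction)
open import Relation.Nullary.Decidable using (recompute)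

private
  variable
    m n k w j : ℕ

module ↔-Reasoning = EquationalReasoning {k = bijection}

length-allFin : ∀ n → length (allFin n) ≡ n
length-allFin n = List.length-tabulate id

length-drop-+ : ∀ {A : Set} {a b} (ys : List A) → length ys ≡ a + b → length (drop a ys) ≡ b
length-drop-+ {a = a} {b} ys len = begin
  length (drop a ys) ≡⟨ List.length-drop a ys ⟩
  length ys ∸ a      ≡⟨ cong (_∸ a) len ⟩
  a + b ∸ a          ≡⟨ m+n∸m≡n a b ⟩
  b                  ∎
  where open ≡-Reasoning

length≡+⇒≤ : ∀ {A : Set} {a b} (ys : List A) → length ys ≡ a + b → a ≤ length ys
length≡+⇒≤ {a = a} {b} ys len = subst (a ≤_) (sym len) (m≤m+n a b)

×-Σ-comm : ∀ {A : Set} {B : ℕ → Set} → (A × Σ ℕ B) ↔ Σ ℕ (λ k → A × B k)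
×-Σ-comm = mk↔ₛ′ (λ (a , k , b) → k , a , b) (λ (k , a , b) → a , k , b) (λ _ → refl) (λ _ → refl)

Σ-Fin-suc : ∀ {B : Fin (suc n) → Set} → Σ (Fin (suc n)) B ↔ (B zero ⊎ Σ (Fin n) (B ∘ suc))
Σ-Fin-suc = mk↔ₛ′
  (λ { (zero , b) → inj₁ b ; (suc i , b) → inj₂ (i , b) })
  (λ { (inj₁ b) → zero , b ; (inj₂ (i , b)) → suc i , b })
  (λ { (inj₁ b) → refl ; (inj₂ (i , b)) → refl })
  (λ { (zero , b) → refl ; (suc i , b) → refl })

Σ-Fin↔sum : ∀ n (f : ℕ → ℕ) → Σ (Fin n) (λ a → Fin (f (toℕ a))) ↔ Fin (sum (applyUpTo f n))
Σ-Fin↔sum zero    f = mk↔ₛ′ (λ { (() , _) }) (λ ()) (λ ()) (λ { (() , _) })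
Σ-Fin↔sum (suc n) f = begin
  Σ (Fin (suc n)) (λ a → Fin (f (toℕ a)))               ↔⟨ Σ-Fin-suc ⟩
  (Fin (f 0) ⊎ Σ (Fin n) (λ a → Fin (f (suc (toℕ a)))))  ↔⟨ ⊎-cong ↔-refl (Σ-Fin↔sum n (f ∘ suc)) ⟩
  (Fin (f 0) ⊎ Fin (sum (applyUpTo (f ∘ suc) n)))        ↔⟨ Fin.+↔⊎ ⟨
  Fin (sum (applyUpTo f (suc n)))                        ∎
  where open ↔-Reasoning

-- Permutations as arrangements of allFin n

record Arrangement (n : ℕ) : Set where
  constructor arrangement
  field
    word : List (Fin n)
    .↭allFin : word ↭ allFin n

arrangement-cong : ∀ {ys ys' : List (Fin n)} .{p p'} → ys ≡ ys' → arrangement ys p ≡ arrangement ys' p'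
arrangement-cong refl = refl

perm-cong : ∀ {w w' : Vec (Fin n) n} .{u u'} → w ≡ w' → perm w u ≡ perm w' u'
perm-cong refl = refl

length-↭allFin : {ys : List (Fin n)} → ys ↭ allFin n → length ys ≡ n
length-↭allFin {n} p = trans (↭-length p) (length-allFin n)

Unique-toList⁻ : ∀ {A : Set} {w : Vec A n} → Unique (toList w) → Vec.Unique w
Unique-toList⁻ {w = []}    _          = VecAllPairs.[]
Unique-toList⁻ {w = _ ∷ _} (x∉ ListAllPairs.∷ uw) = All.toList⁻ x∉ VecAllPairs.∷ Unique-toList⁻ uw

unique⇒∈ : {w : Vec (Fin n) n} → Vec.Unique w → ∀ y → y ∈ᵥ w
unique⇒∈ {suc n} {w} uw y with any? (y Fin.≟_) w
... | yes y∈w = y∈w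
... | no  y∉w = contradiction (Fin.injective⇒≤ punchOut-injective′) 1+n≰n
  where
  y≢ : ∀ i → y ≢ lookup w i
  y≢ i y≡wᵢ = y∉w (subst (_∈ᵥ w) (sym y≡wᵢ) (∈-lookup i w))
  punchOut-injective′ : Injective _≡_ _≡_ (λ i → punchOut (y≢ i))
  punchOut-injective′ {i} {j} eq = lookup-injective uw i j (Fin.punchOut-injective (y≢ i) (y≢ j) eq)

toList↭allFin : (w : Vec (Fin n) n) → Unique (toList w) → toList w ↭ allFin n
toList↭allFin {n} w uw = ∼bag⇒↭ (unique∧set⇒bag uw (allFin⁺ n)
  (mk⇔ (λ _ → ∈-allFin _) (λ _ → ∈-toList⁺ (unique⇒∈ (Unique-toList⁻ uw) _))))

↭allFin⇒Unique : {ys : List (Fin n)} → ys ↭ allFin n → Unique ys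
↭allFin⇒Unique {n} p = Permutationₛ.Unique-resp-↭ (setoid (Fin n)) (↭⇒↭ₛ (↭-sym p)) (allFin⁺ n)

Perm↔Arrangement : Perm n ↔ Arrangement n
Perm↔Arrangement {n} = mk↔ₛ′ to from to∘from from∘to
  where
  to : Perm n → Arrangement n
  to (perm w uw) = arrangement (toList w) (toList↭allFin w uw)
  toVec : (ys : List (Fin n)) → .(ys ↭ allFin n) → Vec (Fin n) n
  toVec ys p = Vec.cast (length-↭allFin p) (Vec.fromList ys)
  toList-toVec : ∀ ys .p → toList (toVec ys p) ≡ ys
  toList-toVec ys p = trans (Vec.toList-cast _ (Vec.fromList ys)) (Vec.toList∘fromList ys)
  from : Arrangement n → Perm n
  from (arrangement ys p) = perm (toVec ys p) (subst Unique (sym (toList-toVec ys p)) (↭allFin⇒Unique p))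
  to∘from : ∀ a → to (from a) ≡ a
  to∘from (arrangement ys p) = arrangement-cong (toList-toVec ys p)
  from∘to : ∀ π → from (to π) ≡ π
  from∘to (perm w _) = perm-cong (Vec.fromList∘toList w)

-- Shapes and filling

Column : ℕ → ℕ → Set
Column n m = Vec (Maybe (Fin n)) m

readColumn : Column n m → List (Fin n)
readColumn c = concatMap maybeWord (toList c)

support : Column n m → Subset m
support = Vec.map is-just

shape : Matrix n m k → Vec (Subset m) k
shape = Vec.map support

weight : Vec (Subset m) k → ℕ
weight S = Vec.sum (Vec.map ∣_∣ S)

-- The clause for an inside position and an exhausted word is junk; it is
-- never reached when the word is long enough.
columnOf : Subset m → List (Fin n) → Column n m
columnOf []            ys       = []
columnOf (outside ∷ p) ys       = nothing ∷ columnOf p ys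
columnOf (inside ∷ p)  []       = nothing ∷ columnOf p []
columnOf (inside ∷ p)  (y ∷ ys) = just y ∷ columnOf p ys

fill : Vec (Subset m) k → List (Fin n) → Matrix n m k
fill []      ys = []
fill (p ∷ S) ys = columnOf p ys ∷ fill S (drop ∣ p ∣ ys)

length-readColumn : (c : Column n m) → length (readColumn c) ≡ ∣ support c ∣
length-readColumn []            = refl
length-readColumn (nothing ∷ c) = length-readColumn c
length-readColumn (just _ ∷ c)  = cong suc (length-readColumn c)

length-reading : (M : Matrix n m k) → length (reading M) ≡ weight (shape M)
length-reading []      = refl
length-reading (c ∷ M) = trans (List.length-++ (readColumn c)) (cong₂ _+_ (length-readColumn c) (length-reading M))

columnOf-support : (c : Column n m) (ys : List (Fin n)) → columnOf (support c) (readColumn c ++ ys) ≡ c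
columnOf-support []            ys = refl
columnOf-support (nothing ∷ c) ys = cong (nothing ∷_) (columnOf-support c ys)
columnOf-support (just x ∷ c)  ys = cong (just x ∷_) (columnOf-support c ys)

drop-support : (c : Column n m) (ys : List (Fin n)) → drop ∣ support c ∣ (readColumn c ++ ys) ≡ ys
drop-support []            ys = refl
drop-support (nothing ∷ c) ys = drop-support c ys
drop-support (just _ ∷ c)  ys = drop-support c ys

fill-shape : (M : Matrix n m k) → fill (shape M) (reading M) ≡ M
fill-shape []      = refl
fill-shape (c ∷ M) = cong₂ _∷_ (columnOf-support c (reading M))
  (trans (cong (fill (shape M)) (drop-support c (reading M))) (fill-shape M))

support-columnOf : (p : Subset m) {ys : List (Fin n)} → ∣ p ∣ ≤ length ys → support (columnOf p ys) ≡ p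
support-columnOf []            _       = refl
support-columnOf (outside ∷ p) h       = cong (outside ∷_) (support-columnOf p h)
support-columnOf (inside ∷ p)  {[]} ()
support-columnOf (inside ∷ p)  {_ ∷ _} (s≤s h) = cong (inside ∷_) (support-columnOf p h)

readColumn-columnOf : (p : Subset m) {ys : List (Fin n)} → ∣ p ∣ ≤ length ys → readColumn (columnOf p ys) ≡ take ∣ p ∣ ys
readColumn-columnOf []            _       = refl
readColumn-columnOf (outside ∷ p) h       = readColumn-columnOf p h
readColumn-columnOf (inside ∷ p)  {[]} ()
readColumn-columnOf (inside ∷ p)  {y ∷ _} (s≤s h) = cong (y ∷_) (readColumn-columnOf p h)

shape-fill : (S : Vec (Subset m) k) {ys : List (Fin n)} → length ys ≡ weight S → shape (fill S ys) ≡ S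
shape-fill []      _        = refl
shape-fill (p ∷ S) {ys} len =
  cong₂ _∷_ (support-columnOf p (length≡+⇒≤ ys len)) (shape-fill S (length-drop-+ ys len))

reading-fill : (S : Vec (Subset m) k) {ys : List (Fin n)} → length ys ≡ weight S → reading (fill S ys) ≡ ys
reading-fill []      {[]} _ = refl
reading-fill (p ∷ S) {ys} len = begin
  readColumn (columnOf p ys) ++ reading (fill S (drop ∣ p ∣ ys))
    ≡⟨ cong₂ _++_ (readColumn-columnOf p (length≡+⇒≤ ys len)) (reading-fill S (length-drop-+ ys len)) ⟩
  take ∣ p ∣ ys ++ (drop ∣ p ∣ ys)
    ≡⟨ List.take++drop≡id ∣ p ∣ ys ⟩
  ys ∎
  where open ≡-Reasoning

-- 0/1 matrices without zero columns

NonzeroColumns : Vec (Subset m) k → Set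
NonzeroColumns = All (λ p → 0 < ∣ p ∣)

Is-just⇒nonzero : {c : Column n m} → Any Is-just c → 0 < ∣ support c ∣
Is-just⇒nonzero {c = just _ ∷ _}  _         = z<s
Is-just⇒nonzero {c = nothing ∷ _} (here ())
Is-just⇒nonzero {c = nothing ∷ _} (there a) = Is-just⇒nonzero a

nonzero⇒Is-just : {c : Column n m} → 0 < ∣ support c ∣ → Any Is-just c
nonzero⇒Is-just {c = just _ ∷ _}  _ = here (Maybe.just tt)
nonzero⇒Is-just {c = nothing ∷ _} h = there (nonzero⇒Is-just h)

shape-nonzero : {M : Matrix n m k} → All (Any Is-just) M → NonzeroColumns (shape M)
shape-nonzero = All.map⁺ ∘ All.map Is-just⇒nonzero

nonzero-shape : {M : Matrix n m k} → NonzeroColumns (shape M) → All (Any Is-just) M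
nonzero-shape = All.map nonzero⇒Is-just ∘ All.map⁻

record Mat01 (m w k : ℕ) : Set where
  constructor mat01
  field
    columns : Vec (Subset m) k
    .ones : weight columns ≡ w
    .nonzero : NonzeroColumns columns

Matrix01 : ℕ → ℕ → Set
Matrix01 m w = Σ ℕ (Mat01 m w)

mat01-cong : ∀ {S S' : Vec (Subset m) k} .{o o' z z'} → S ≡ S' → mat01 {w = w} S o z ≡ mat01 S' o' z'
mat01-cong refl = refl

g01-cong : ∀ {M M' : Matrix n m k} .{r r' z z'} → M ≡ M' → g01 M r z ≡ g01 M' r' z'
g01-cong refl = refl

lstr-cong : ∀ {M M' : Matrix n m k} .{r r' z z'} → M ≡ M' → lstr M r z ≡ lstr M' r' z'
lstr-cong refl = refl

toMat01 : (M : Matrix n m k) → .(length (reading M) ≡ w) → .(All (Any Is-just) M) → Mat01 m w k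
toMat01 M len z = mat01 (shape M) (trans (sym (length-reading M)) len) (shape-nonzero z)

fromMat01 : List (Fin n) → Mat01 m w k → Matrix n m k
fromMat01 ys A = fill (Mat01.columns A) ys

module _ (ys : List (Fin n)) .(len : length ys ≡ w) where

  length≡weight : (A : Mat01 m w k) → length ys ≡ weight (Mat01.columns A)
  length≡weight (mat01 S o _) = recompute (length ys ≟ weight S) (trans len (sym o))

  shape-fromMat01 : (A : Mat01 m w k) → shape (fromMat01 ys A) ≡ Mat01.columns A
  shape-fromMat01 A = shape-fill (Mat01.columns A) (length≡weight A)

  reading-fromMat01 : (A : Mat01 m w k) → reading (fromMat01 ys A) ≡ ys
  reading-fromMat01 A = reading-fill (Mat01.columns A) (length≡weight A)

  nonzero-fromMat01 : (A : Mat01 m w k) → NonzeroColumns (Mat01.columns A) → All (Any Is-just) (fromMat01 ys A)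
  nonzero-fromMat01 A z = nonzero-shape (subst NonzeroColumns (sym (shape-fromMat01 A)) z)

G01Mat↔Mat01 : G01Mat m n k ↔ Mat01 m n k
G01Mat↔Mat01 {n = n} = mk↔ₛ′ to from to∘from from∘to
  where
  to : G01Mat _ n _ → Mat01 _ n _
  to (g01 M r z) = toMat01 M (trans (cong length r) (length-allFin n)) z
  from : Mat01 _ n _ → G01Mat _ n _
  from A@(mat01 _ _ z) = g01 (fromMat01 (allFin n) A) (reading-fromMat01 _ (length-allFin n) A)
    (nonzero-fromMat01 _ (length-allFin n) A z)
  to∘from : ∀ A → to (from A) ≡ A
  to∘from A = mat01-cong (shape-fromMat01 (allFin n) (length-allFin n) A)
  from∘to : ∀ M → from (to M) ≡ M
  from∘to (g01 M r _) = g01-cong (trans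
    (cong (fill (shape M)) (sym (recompute (List.≡-dec Fin._≟_ (reading M) (allFin n)) r)))
    (fill-shape M))

G01↔Matrix01 : G01 m n ↔ Matrix01 m n
G01↔Matrix01 = Σ-↔ ↔-refl G01Mat↔Mat01

LMat↔Arrangement×Mat01 : LMat m n k ↔ (Arrangement n × Mat01 m n k)
LMat↔Arrangement×Mat01 {n = n} = mk↔ₛ′ to from to∘from from∘to
  where
  to : LMat _ n _ → Arrangement n × Mat01 _ n _
  to (lstr B p z) = arrangement (reading B) p , toMat01 B (length-↭allFin p) z
  from : Arrangement n × Mat01 _ n _ → LMat _ n _
  from (arrangement ys p , A@(mat01 _ _ z)) = lstr (fromMat01 ys A)
    (subst (_↭ allFin n) (sym (reading-fromMat01 ys (length-↭allFin p) A)) p)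
    (nonzero-fromMat01 ys (length-↭allFin p) A z)
  to∘from : ∀ x → to (from x) ≡ x
  to∘from (arrangement ys p , A) = cong₂ _,_
    (arrangement-cong (reading-fromMat01 ys (length-↭allFin p) A))
    (mat01-cong (shape-fromMat01 ys (length-↭allFin p) A))
  from∘to : ∀ L → from (to L) ≡ L
  from∘to (lstr B _ _) = lstr-cong (fill-shape B)

Perm×G01↔LStr : (Perm n × G01 m n) ↔ LStr m n
Perm×G01↔LStr {n} {m} = begin
  (Perm n × G01 m n)                        ↔⟨ ×-cong Perm↔Arrangement G01↔Matrix01 ⟩
  (Arrangement n × Matrix01 m n)            ↔⟨ ×-Σ-comm ⟩
  Σ ℕ (λ k → Arrangement n × Mat01 m n k)   ↔⟨ Σ-↔ ↔-refl LMat↔Arrangement×Mat01 ⟨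
  LStr m n                                  ∎
  where open ↔-Reasoning

-- Counting

record SizedSubset (m j : ℕ) : Set where
  constructor sized
  field
    subset : Subset m
    .size : ∣ subset ∣ ≡ j

sized-cong : ∀ {p p' : Subset m} .{s s'} → p ≡ p' → sized {j = j} p s ≡ sized p' s'
sized-cong refl = refl

∣p∣≡0⇒p≡∅ : {p : Subset m} → ∣ p ∣ ≡ 0 → p ≡ ∅
∣p∣≡0⇒p≡∅ {p = []}          _ = refl
∣p∣≡0⇒p≡∅ {p = outside ∷ p} e = cong (outside ∷_) (∣p∣≡0⇒p≡∅ e)

SizedSubset-zero↔ : SizedSubset m 0 ↔ Fin 1
SizedSubset-zero↔ {m} = mk↔ₛ′ (λ _ → zero) (λ _ → sized ∅ (∣∅∣≡0 m)) (λ { zero → refl })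
  (λ { (sized p s) → sized-cong (sym (∣p∣≡0⇒p≡∅ (recompute (∣ p ∣ ≟ 0) s))) })

SizedSubset-suc↔ : SizedSubset (suc m) (suc j) ↔ (SizedSubset m j ⊎ SizedSubset m (suc j))
SizedSubset-suc↔ = mk↔ₛ′
  (λ { (sized (inside ∷ p) s) → inj₁ (sized p (suc-injective s)) ; (sized (outside ∷ p) s) → inj₂ (sized p s) })
  (λ { (inj₁ (sized p s)) → sized (inside ∷ p) (cong suc s) ; (inj₂ (sized p s)) → sized (outside ∷ p) s })
  (λ { (inj₁ _) → refl ; (inj₂ _) → refl })
  (λ { (sized (inside ∷ _) _) → refl ; (sized (outside ∷ _) _) → refl })

SizedSubset↔Fin[C] : ∀ m j → SizedSubset m j ↔ Fin (m C j)
SizedSubset↔Fin[C] m       zero    = SizedSubset-zero↔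
SizedSubset↔Fin[C] zero    (suc j) = mk↔ₛ′ (λ { (sized [] s) → ⊥-elim-irr (0≢1+n s) }) (λ ()) (λ ())
  (λ { (sized [] s) → ⊥-elim-irr (0≢1+n s) })
SizedSubset↔Fin[C] (suc m) (suc j) = begin
  SizedSubset (suc m) (suc j)              ↔⟨ SizedSubset-suc↔ ⟩
  (SizedSubset m j ⊎ SizedSubset m (suc j)) ↔⟨ ⊎-cong (SizedSubset↔Fin[C] m j) (SizedSubset↔Fin[C] m (suc j)) ⟩
  (Fin (m C j) ⊎ Fin (m C suc j))          ↔⟨ Fin.+↔⊎ ⟨
  Fin (m C j + m C suc j)                  ≡⟨ cong Fin (nCk+nC[k+1]≡[n+1]C[k+1] m j) ⟩
  Fin (suc m C suc j)                      ∎
  where open ↔-Reasoning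

Matrix01-zero↔ : Matrix01 m 0 ↔ Fin 1
Matrix01-zero↔ = mk↔ₛ′ (λ _ → zero) (λ _ → 0 , mat01 [] refl []) (λ { zero → refl }) from∘to
  where
  from∘to : ∀ A → (0 , mat01 [] refl []) ≡ A
  from∘to (zero  , mat01 []      _ _) = refl
  from∘to (suc _ , mat01 (p ∷ _) o z) = ⊥-elim-irr (<⇒≢ (All.head z) (sym (m+n≡0⇒m≡0 ∣ p ∣ o)))

pred+≡ : ∀ {c w n} → 0 < c → c + w ≡ suc n → pred c + w ≡ n
pred+≡ {suc _} _ = suc-injective

firstColumn-split : ∀ {c w n} → 0 < c → c + w ≡ suc n → (a : Fin (suc n)) → toℕ a ≡ pred c →
  c ≡ suc (toℕ a) × w ≡ n ∸ toℕ a
firstColumn-split {suc _} {w} _ o a refl = refl , trans (sym (m+n∸m≡n (toℕ a) w)) (cong (_∸ toℕ a) (suc-injective o))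

firstColumn-join : ∀ {c w n} (a : Fin (suc n)) → c ≡ suc (toℕ a) → w ≡ n ∸ toℕ a → c + w ≡ suc n
firstColumn-join a refl refl = cong suc (m+[n∸m]≡n (Fin.toℕ≤pred[n] a))

FirstColumnSplit : ℕ → ℕ → Set
FirstColumnSplit m n = Σ (Fin (suc n)) (λ a → SizedSubset m (suc (toℕ a)) × Matrix01 m (n ∸ toℕ a))

Matrix01-suc↔ : Matrix01 m (suc n) ↔ FirstColumnSplit m n
Matrix01-suc↔ {m} {n} = mk↔ₛ′ to from to∘from from∘to
  where
  index : (p : Subset m) (S : Vec (Subset m) k) → .(0 < ∣ p ∣) → .(∣ p ∣ + weight S ≡ suc n) → Fin (suc n)
  index p S p>0 o = fromℕ< {pred ∣ p ∣} (s≤s (≤-trans (m≤m+n _ (weight S)) (≤-reflexive (pred+≡ p>0 o))))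
  index-split : (p : Subset m) (S : Vec (Subset m) k) (p>0 : 0 < ∣ p ∣) (o : ∣ p ∣ + weight S ≡ suc n) →
    ∣ p ∣ ≡ suc (toℕ (index p S p>0 o)) × weight S ≡ n ∸ toℕ (index p S p>0 o)
  index-split p S p>0 o = firstColumn-split p>0 o _ (Fin.toℕ-fromℕ< _)
  to : Matrix01 m (suc n) → FirstColumnSplit m n
  to (zero  , mat01 []      o _) = ⊥-elim-irr (0≢1+n o)
  to (suc k , mat01 (p ∷ S) o z) = index p S (All.head z) o ,
    sized p (proj₁ (index-split p S (All.head z) o)) ,
    k , mat01 S (proj₂ (index-split p S (All.head z) o)) (All.tail z)
  from : FirstColumnSplit m n → Matrix01 m (suc n)
  from (a , sized p s , k , mat01 S o z) =
    suc k , mat01 (p ∷ S) (firstColumn-join a s o) (subst (0 <_) (sym s) z<s ∷ z)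
  split-cong : ∀ {a a'} (e : a ≡ a') {p S} .{s s' o o' z z'} →
    _≡_ {A = FirstColumnSplit m n} (a , sized p s , k , mat01 S o z) (a' , sized p s' , k , mat01 S o' z')
  split-cong refl = refl
  to∘from : ∀ x → to (from x) ≡ x
  to∘from (a , sized p s , k , mat01 S o z) = split-cong (Fin.toℕ-injective
    (trans (Fin.toℕ-fromℕ< _) (cong pred (recompute (∣ p ∣ ≟ suc (toℕ a)) s))))
  from∘to : ∀ A → from (to A) ≡ A
  from∘to (zero  , mat01 []      o _) = ⊥-elim-irr (0≢1+n o)
  from∘to (suc _ , mat01 (_ ∷ _) _ _) = refl

binomialProduct : ℕ → List ℕ → ℕ
binomialProduct m α = product (map (m C_) α)

-- compositionSum m n is compositionSum′ m n n; the recursion on the first part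
-- needs the fuel f kept apart from n.
compositionSum′ : ℕ → ℕ → ℕ → ℕ
compositionSum′ m f n = sum (map (binomialProduct m) (compositions' f n))

sum-map-concatMap : ∀ {A B : Set} (g : B → ℕ) (h : A → List B) xs →
  sum (map g (concatMap h xs)) ≡ sum (map (λ x → sum (map g (h x))) xs)
sum-map-concatMap g h []       = refl
sum-map-concatMap g h (x ∷ xs) = begin
  sum (map g (h x ++ concatMap h xs))               ≡⟨ cong sum (List.map-++ g (h x) _) ⟩
  sum (map g (h x) ++ map g (concatMap h xs))       ≡⟨ sum-++ (map g (h x)) _ ⟩
  sum (map g (h x)) + sum (map g (concatMap h xs))  ≡⟨ cong (sum (map g (h x)) +_) (sum-map-concatMap g h xs) ⟩
  sum (map g (h x)) + sum (map (λ x → sum (map g (h x))) xs) ∎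
  where open ≡-Reasoning

sum-map-*ˡ : ∀ {A : Set} c (f : A → ℕ) xs → sum (map (λ x → c * f x) xs) ≡ c * sum (map f xs)
sum-map-*ˡ c f []       = sym (*-zeroʳ c)
sum-map-*ˡ c f (x ∷ xs) = trans (cong (c * f x +_) (sum-map-*ˡ c f xs)) (sym (*-distribˡ-+ c (f x) _))

compositionSum′-suc : ∀ m f n →
  compositionSum′ m (suc f) (suc n) ≡ sum (applyUpTo (λ a → (m C suc a) * compositionSum′ m f (n ∸ a)) (suc n))
compositionSum′-suc m f n = begin
  sum (map P (concatMap (λ a → map (suc a ∷_) (compositions' f (n ∸ a))) (applyUpTo id (suc n))))
    ≡⟨ sum-map-concatMap P (λ a → map (suc a ∷_) (compositions' f (n ∸ a))) (applyUpTo id (suc n)) ⟩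
  sum (map (λ a → sum (map P (map (suc a ∷_) (compositions' f (n ∸ a))))) (applyUpTo id (suc n)))
    ≡⟨ cong sum (List.map-cong firstPart (applyUpTo id (suc n))) ⟩
  sum (map (λ a → (m C suc a) * compositionSum′ m f (n ∸ a)) (applyUpTo id (suc n)))
    ≡⟨ cong sum (List.map-applyUpTo id _ (suc n)) ⟩
  sum (applyUpTo (λ a → (m C suc a) * compositionSum′ m f (n ∸ a)) (suc n)) ∎
  where
  open ≡-Reasoning
  P = binomialProduct m
  firstPart : ∀ a → sum (map P (map (suc a ∷_) (compositions' f (n ∸ a)))) ≡ (m C suc a) * compositionSum′ m f (n ∸ a)
  firstPart a = trans (cong sum (sym (List.map-∘ αs))) (sum-map-*ˡ (m C suc a) P αs)
    where αs = compositions' f (n ∸ a)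

Matrix01↔Fin : ∀ f n → n ≤ f → Matrix01 m n ↔ Fin (compositionSum′ m f n)
Matrix01↔Fin     f       zero    _         = Matrix01-zero↔
Matrix01↔Fin {m} (suc f) (suc n) (s≤s n≤f) = begin
  Matrix01 m (suc n)
    ↔⟨ Matrix01-suc↔ ⟩
  FirstColumnSplit m n
    ↔⟨ Σ-↔ ↔-refl (λ {a} → ×-cong (SizedSubset↔Fin[C] m (suc (toℕ a))) (rest a)) ⟩
  Σ (Fin (suc n)) (λ a → Fin (m C suc (toℕ a)) × Fin (compositionSum′ m f (n ∸ toℕ a)))
    ↔⟨ Σ-↔ ↔-refl Fin.*↔× ⟨
  Σ (Fin (suc n)) (λ a → Fin ((m C suc (toℕ a)) * compositionSum′ m f (n ∸ toℕ a)))
    ↔⟨ Σ-Fin↔sum (suc n) (λ a → (m C suc a) * compositionSum′ m f (n ∸ a)) ⟩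
  Fin (sum (applyUpTo (λ a → (m C suc a) * compositionSum′ m f (n ∸ a)) (suc n)))
    ≡⟨ cong Fin (compositionSum′-suc m f n) ⟨
  Fin (compositionSum′ m (suc f) (suc n)) ∎
  where
  open ↔-Reasoning
  rest : (a : Fin (suc n)) → Matrix01 m (n ∸ toℕ a) ↔ Fin (compositionSum′ m f (n ∸ toℕ a))
  rest a = Matrix01↔Fin f (n ∸ toℕ a) (≤-trans (m∸n≤m n (toℕ a)) n≤f)

proposition4p10 : (n m : ℕ) →
    ((Perm n × G01 m n) ↔ LStr m n) × (G01 m n ↔ Fin (compositionSum m n))
proposition4p10 n m = Perm×G01↔LStr , ↔-trans G01↔Matrix01 (Matrix01↔Fin n n ≤-refl)
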